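{- Let $H$ be a simple strongly connected digraph with at least one arc, let $k$ be a positive integer and $c\ge 0$. Let $T$ be a tournament with $\mathrm{ctw}(T)\le c$ that does not contain $k$ pairwise vertex-disjoint immersion copies of $H$. Then there is a set $F$ of at most $2(k-1)c$ arcs of $T$ that is $H$-hitting, i.e., $T-F$ does not contain $H$ as an immersion.
   Context: A tournament is a simple digraph in which every pair of distinct vertices is joined by exactly one arc. An immersion copy of $H$ is a digraph $\widehat H$ with a mapping sending vertices of $H$ to distinct vertices and arcs $(u,v)$ of $H$ to directed paths from the image of $u$ to the image of $v$, every arc of $\widehat H$ lying on exactly one of these paths; a digraph contains $H$ as an immersion if it has a subgraph that is an immersion copy of $H$. For a tournament $T=(V,A)$ and a bijection $\sigma\colon V\to[|V|]$, the $\alpha$-cut is $\{(u,v)\in A:\sigma(u)>\alpha\ge\sigma(v)\}$; the width of $\sigma$ is the maximum size of an $\alpha$-cut over $\alpha\in\{0,\dots,|V|\}$, and the cutwidth $\mathrm{ctw}(T)$ is the minimum width over all $\sigma$. -}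

module Defs where

open import Data.Nat using (ℕ; zero; suc; _+_; _*_; _∸_; _≤_; _<_; _≤ᵇ_; _<ᵇ_; _⊔_)
open import Data.Bool using (Bool; true; false; not; _∧_; if_then_else_)
open import Data.Fin using (Fin; toℕ)
open import Data.Nat.ListAction using (sum)
open import Data.List using (List; []; _∷_; map; foldr; upTo; allFin; cartesianProduct; length)
open import Data.List.Membership.Propositional using (_∈_; _∉_)
open import Data.List.Relation.Unary.All using (All)
open import Data.List.Relation.Unary.Unique.Propositional using (Unique)
open import Data.Product using (Σ; ∃; ∃-syntax; _×_; _,_)
open import Data.Sum using (_⊎_)
open import Data.Empty using (⊥)
open import Relation.Nullary using (¬_)
open import Relation.Binary.PropositionalEquality using (_≡_; _≢_)
open import Function.Bundles using (Bijection; _⤖_)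
open import Function.Definitions using (Injective)

record Digraph : Set where
  field
    size : ℕ
    adj  : Fin size → Fin size → Bool

-- simple: no loops (and no parallel arcs by representation)
IsSimple : Digraph → Set
IsSimple D = ∀ v → Digraph.adj D v v ≡ false

Arc : (D : Digraph) → Fin (Digraph.size D) → Fin (Digraph.size D) → Set
Arc D u v = Digraph.adj D u v ≡ true

data Walk {n : ℕ} (R : Fin n → Fin n → Set) : Fin n → Fin n → Set where
  []  : ∀ {x} → Walk R x x
  _∷_ : ∀ {x y z} → R x y → Walk R y z → Walk R x z

verts : ∀ {n} {R : Fin n → Fin n → Set} {x y} → Walk R x y → List (Fin n)
verts {x = x} []       = x ∷ []
verts {x = x} (_ ∷ w)  = x ∷ verts w

arcs : ∀ {n} {R : Fin n → Fin n → Set} {x y} → Walk R x y → List (Fin n × Fin n)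
arcs []               = []
arcs {x = x} (_∷_ {y = y} _ w) = (x , y) ∷ arcs w

IsPath : ∀ {n} {R : Fin n → Fin n → Set} {x y} → Walk R x y → Set
IsPath w = Unique (verts w)

StronglyConnected : Digraph → Set
StronglyConnected D = ∀ u v → Walk (Arc D) u v

HasArc : Digraph → Set
HasArc D = ∃[ u ] ∃[ v ] Arc D u v

IsTournament : Digraph → Set
IsTournament T = IsSimple T
  × (∀ u v → u ≢ v → Digraph.adj T u v ≡ not (Digraph.adj T v u))

record Immersion (H : Digraph) {n : ℕ} (R : Fin n → Fin n → Set) : Set where
  field
    φ       : Fin (Digraph.size H) → Fin n
    φ-inj   : Injective _≡_ _≡_ φ
    route   : ∀ a b → Arc H a b → Walk R (φ a) (φ b)
    isPath  : ∀ a b (p : Arc H a b) → IsPath (route a b p)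
    arcDisj : ∀ a b (p : Arc H a b) a' b' (p' : Arc H a' b') → (a , b) ≢ (a' , b') →
              ∀ e → e ∈ arcs (route a b p) → e ∈ arcs (route a' b' p') → ⊥

InCopy : ∀ {H n} {R : Fin n → Fin n → Set} → Immersion H R → Fin n → Set
InCopy {H} I v =
  (∃[ a ] Immersion.φ I a ≡ v)
  ⊎ (∃[ a ] ∃[ b ] Σ (Arc H a b) λ p → v ∈ verts (Immersion.route I a b p))

ContainsImmersion : (H : Digraph) {n : ℕ} (R : Fin n → Fin n → Set) → Set
ContainsImmersion H R = Immersion H R

HasDisjointCopies : ℕ → (H : Digraph) {n : ℕ} (R : Fin n → Fin n → Set) → Set
HasDisjointCopies k H R =
  Σ (Fin k → Immersion H R) λ cs →
    ∀ i j → i ≢ j → ∀ v → InCopy (cs i) v → InCopy (cs j) v → ⊥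

Delete : (D : Digraph) → List (Fin (Digraph.size D) × Fin (Digraph.size D)) →
         Fin (Digraph.size D) → Fin (Digraph.size D) → Set
Delete D F u v = Arc D u v × (u , v) ∉ F

-- cutwidth.  σ : V → Fin n is a bijection; paper's σ(v) ∈ [n] is toℕ (σ v) + 1.
-- α-cut = {(u,v) ∈ A : σ(u) > α ≥ σ(v)}, i.e. toℕ σu ≥ α > toℕ σv.
cutSize : (D : Digraph) → (Fin (Digraph.size D) → Fin (Digraph.size D)) → ℕ → ℕ
cutSize D σ α =
  sum (map (λ { (u , v) → if Digraph.adj D u v ∧ (α ≤ᵇ toℕ (σ u)) ∧ (toℕ (σ v) <ᵇ α)
                          then 1 else 0 })
           (cartesianProduct (allFin (Digraph.size D)) (allFin (Digraph.size D))))

width : (D : Digraph) → (Fin (Digraph.size D) → Fin (Digraph.size D)) → ℕ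
width D σ = foldr _⊔_ 0 (map (cutSize D σ) (upTo (suc (Digraph.size D))))

CtwAtMost : Digraph → ℕ → Set
CtwAtMost D c = Σ (Fin (Digraph.size D) ⤖ Fin (Digraph.size D))
                  λ σ → width D (Bijection.to σ) ≤ c

module Submission where

-- Order the vertices of T by a σ of width ≤ c and write pos v for the position of v.  If F contains
-- the α-cut, T − F has no arc from positions ≥ α to positions < α, so every copy of the strongly
-- connected H in T − F lies entirely on one side of α.  Above the current lower position β, pick γ
-- such that positions β … γ carry a copy C of H but positions β … γ − 1 do not, and delete the cuts
-- at γ and γ + 1 (at most 2c arcs).  A remaining copy then lies at positions > γ, or at the single
-- position γ (impossible, H having two vertices), or in β … γ − 1 (impossible by the choice of γ).
-- Copies at positions > γ are disjoint from C, so at most k − 2 of them are pairwise disjoint, and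
-- the recursion above γ deletes at most 2(k − 2)c further arcs.

open import Defs
open import Data.Nat using (ℕ; zero; suc; _+_; _*_; _∸_; _≤_; _<_; _≥_; _≤?_; _<?_; _≤ᵇ_; _<ᵇ_; _⊔_; z≤n; s≤s)
open import Data.Nat.Properties
  using (module ≤-Reasoning; ≤-refl; ≤-trans; <-≤-trans; ≰⇒>; <⇒≱; <⇒≤; ≤-antisym; ≤-pred; n≮0;
         m≤n⇒m≤1+n; m≤m⊔n; m≤n⊔m; ≤⇒≤ᵇ; <⇒<ᵇ; +-mono-≤)
open import Data.Nat.ListAction using (sum)
open import Data.Nat.Tactic.RingSolver using (solve-∀)
open import Data.Bool using (Bool; true; false; _∧_; if_then_else_)
import Data.Bool as Bool
open import Data.Bool.Properties using (T-∧; T-≡)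
open import Data.Fin using (Fin; toℕ)
import Data.Fin as Fin
import Data.Fin.Properties as Fin
open import Data.Vec using (Vec; []; _∷_; tabulate)
import Data.Vec as Vec
open import Data.Vec.Properties using (lookup∘tabulate)
open import Data.List
  using (List; []; _∷_; length; lookup; map; foldr; allFin; cartesianProduct; cartesianProductWith;
         filterᵇ; _++_)
open import Data.List.Properties using (∷-injective; length-++)
open import Data.List.Membership.Propositional using (_∈_; _∉_)
open import Data.List.Membership.Propositional.Properties
  using (∈-lookup; ∈-allFin; ∈-cartesianProductWith⁺; ∈-cartesianProduct⁺; ∈-map⁺; ∈-upTo⁺;
         ∈-filter⁺; ∈-filter⁻; ∈-++⁺ˡ; ∈-++⁺ʳ)
import Data.List.Membership.DecPropositional as MembershipDec
open import Data.List.Relation.Unary.All as All using (All; []; _∷_)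
import Data.List.Relation.Unary.All.Properties as All
open import Data.List.Relation.Unary.Any as Any using (here; there)
open import Data.List.Relation.Unary.Any.Properties using (lookup-index)
open import Data.List.Relation.Unary.AllPairs using (_∷_)
open import Data.List.Relation.Unary.Unique.Propositional using (Unique)
import Data.List.Relation.Unary.Unique.DecPropositional as UniqueDec
open import Data.Product using (Σ; ∃; ∃-syntax; _×_; _,_; proj₁; proj₂)
open import Data.Product.Properties using (≡-dec)
open import Data.Sum using (_⊎_; inj₁; inj₂; [_,_])
open import Data.Empty using (⊥; ⊥-elim)
open import Function using (_∘_; Equivalence)
open import Function.Bundles using (Bijection)
open import Function.Definitions using (Injective)
open import Relation.Binary.Core using (_⇒_)
open import Relation.Binary.PropositionalEquality using (_≡_; _≢_; refl; sym; trans; cong; subst; subst₂)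
open import Relation.Nullary using (¬_; Dec; yes; no; contradiction; ¬?)
open import Relation.Nullary.Decidable using (map′; _×-dec_; _→-dec_)
open import Relation.Unary using (Decidable; _⊆_; ∁)

open Immersion

private variable
  n k : ℕ
  A : Set
  H : Digraph
  R R′ : Fin n → Fin n → Set
  P U : Fin n → Set
  x y v : Fin n

_↾_ : (Fin n → Fin n → Set) → (Fin n → Set) → Fin n → Fin n → Set
(R ↾ P) u v = R u v × P u × P v

Closed : (Fin n → Fin n → Set) → (Fin n → Set) → Set
Closed R U = ∀ {u v} → R u v → U u → U v

steps : List (Fin n) → List (Fin n × Fin n)
steps (x ∷ y ∷ l) = (x , y) ∷ steps (y ∷ l)
steps _           = []

arcs≡steps : (w : Walk R x y) → arcs w ≡ steps (verts w)
arcs≡steps []            = refl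
arcs≡steps (r ∷ [])      = refl
arcs≡steps (r ∷ r′ ∷ w)  = cong (_ ∷_) (arcs≡steps (r′ ∷ w))

mapᵂ : R ⇒ R′ → Walk R x y → Walk R′ x y
mapᵂ f []      = []
mapᵂ f (r ∷ w) = f r ∷ mapᵂ f w

verts-mapᵂ : (f : R ⇒ R′) (w : Walk R x y) → verts (mapᵂ f w) ≡ verts w
verts-mapᵂ f []      = refl
verts-mapᵂ f (r ∷ w) = cong (_ ∷_) (verts-mapᵂ f w)

restrictᵂ : (w : Walk R x y) → All P (verts w) → Walk (R ↾ P) x y
restrictᵂ []      _                        = []
restrictᵂ (r ∷ []) (px ∷ py ∷ [])          = (r , px , py) ∷ []
restrictᵂ (r ∷ r′ ∷ w) (px ∷ ps@(py ∷ _))  = (r , px , py) ∷ restrictᵂ (r′ ∷ w) ps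

verts-restrictᵂ : (w : Walk R x y) (ps : All P (verts w)) → verts (restrictᵂ w ps) ≡ verts w
verts-restrictᵂ []           _                  = refl
verts-restrictᵂ (r ∷ [])     (_ ∷ _ ∷ [])       = refl
verts-restrictᵂ (r ∷ r′ ∷ w) (_ ∷ ps@(_ ∷ _))   = cong (_ ∷_) (verts-restrictᵂ (r′ ∷ w) ps)

↾-verts : (w : Walk (R ↾ P) x y) → P x → All P (verts w)
↾-verts []                  px = px ∷ []
↾-verts ((_ , _ , py) ∷ w) px = px ∷ ↾-verts w py

↾-source : Walk (R ↾ P) x y → x ≢ y → P x
↾-source []                 x≢x = contradiction refl x≢x
↾-source ((_ , px , _) ∷ _) _   = px

Closed-↾ : Closed R U → Closed (R ↾ P) U
Closed-↾ cl (r , _) = cl r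

closed-walk : Closed R U → Walk R x y → U x → U y
closed-walk cl []      ux = ux
closed-walk cl (r ∷ w) ux = closed-walk cl w (cl r ux)

closed-verts : Closed R U → (w : Walk R x y) → U x → All U (verts w)
closed-verts cl []      ux = ux ∷ []
closed-verts cl (r ∷ w) ux = ux ∷ closed-verts cl w (cl r ux)

closed-∈verts : Closed R U → (w : Walk R x y) → v ∈ verts w → U v → U y
closed-∈verts cl []      (here refl) uv = uv
closed-∈verts cl (r ∷ w) (here refl) uv = closed-walk cl (r ∷ w) uv
closed-∈verts cl (r ∷ w) (there v∈) uv = closed-∈verts cl w v∈ uv

arc⇒≢ : ∀ {H : Digraph} {a b} → IsSimple H → Arc H a b → a ≢ b
arc⇒≢ {H} {a} sim p refl with trans (sym p) (sim a)
... | ()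

out-arc : StronglyConnected H → HasArc H → ∀ a → ∃[ b ] Arc H a b
out-arc sc (u , v , p) a with sc a u
... | []    = v , p
... | q ∷ _ = _ , q

rerouteᴵ : (I : Immersion H R) (ρ : ∀ a b → Arc H a b → Walk R′ (φ I a) (φ I b)) →
           (∀ a b p → verts (ρ a b p) ≡ verts (route I a b p)) → Immersion H R′
rerouteᴵ I ρ same = record
  { φ       = φ I
  ; φ-inj   = φ-inj I
  ; route   = ρ
  ; isPath  = λ a b p → subst Unique (sym (same a b p)) (isPath I a b p)
  ; arcDisj = λ a b p a′ b′ p′ ne e e∈ e∈′ →
      arcDisj I a b p a′ b′ p′ ne e
        (subst (e ∈_) (same-arcs a b p) e∈) (subst (e ∈_) (same-arcs a′ b′ p′) e∈′)
  }
  where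
  same-arcs : ∀ a b p → arcs (ρ a b p) ≡ arcs (route I a b p)
  same-arcs a b p = trans (arcs≡steps (ρ a b p))
    (trans (cong steps (same a b p)) (sym (arcs≡steps (route I a b p))))

InCopy-rerouteᴵ⁻ : (I : Immersion H R) (ρ : ∀ a b → Arc H a b → Walk R′ (φ I a) (φ I b))
                   (same : ∀ a b p → verts (ρ a b p) ≡ verts (route I a b p)) →
                   InCopy (rerouteᴵ I ρ same) ⊆ InCopy I
InCopy-rerouteᴵ⁻ I ρ same (inj₁ v∈φ)               = inj₁ v∈φ
InCopy-rerouteᴵ⁻ I ρ same (inj₂ (a , b , p , v∈)) = inj₂ (a , b , p , subst (_ ∈_) (same a b p) v∈)

mapᴵ : R ⇒ R′ → Immersion H R → Immersion H R′
mapᴵ f I = rerouteᴵ I (λ a b p → mapᵂ f (route I a b p)) (λ a b p → verts-mapᵂ f (route I a b p))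

InCopy-mapᴵ⁻ : (f : R ⇒ R′) (I : Immersion H R) → InCopy (mapᴵ f I) ⊆ InCopy I
InCopy-mapᴵ⁻ f I = InCopy-rerouteᴵ⁻ I _ (λ a b p → verts-mapᵂ f (route I a b p))

restrictᴵ : (I : Immersion H R) → InCopy I ⊆ P → Immersion H (R ↾ P)
restrictᴵ I ⊆P = rerouteᴵ I (λ a b p → restrictᵂ (route I a b p) (on-route a b p))
  (λ a b p → verts-restrictᵂ (route I a b p) (on-route a b p))
  where
  on-route : ∀ a b p → All _ (verts (route I a b p))
  on-route a b p = All.tabulate (λ v∈ → ⊆P (inj₂ (a , b , p , v∈)))

φ-↾ : IsSimple H → (∀ a → ∃[ b ] Arc H a b) → (I : Immersion H (R ↾ P)) → ∀ a → P (φ I a)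
φ-↾ {H = H} sim out I a with out a
... | b , p = ↾-source (route I a b p) (λ eq → arc⇒≢ {H} {a} {b} sim p (φ-inj I eq))

InCopy-↾ : IsSimple H → (∀ a → ∃[ b ] Arc H a b) → (I : Immersion H (R ↾ P)) → InCopy I ⊆ P
InCopy-↾ sim out I (inj₁ (a , refl))       = φ-↾ sim out I a
InCopy-↾ sim out I (inj₂ (a , b , p , v∈)) = All.lookup (↾-verts (route I a b p) (φ-↾ sim out I a)) v∈

closed-φ : StronglyConnected H → Closed R U → (I : Immersion H R) → ∀ a b → U (φ I a) → U (φ I b)
closed-φ {H = H} {U = U} sc cl I a b = along (sc a b)
  where
  along : ∀ {a b} → Walk (Arc H) a b → U (φ I a) → U (φ I b)
  along []      u = u
  along (p ∷ w) u = along w (closed-walk cl (route I _ _ p) u)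

InCopy-one-side : StronglyConnected H → Fin (Digraph.size H) → Decidable U → Closed R U →
                  (I : Immersion H R) → InCopy I ⊆ U ⊎ InCopy I ⊆ ∁ U
InCopy-one-side sc a₀ U? cl I with U? (φ I a₀)
... | yes u = inj₁ λ
  { (inj₁ (a , refl))       → φ∈U a
  ; (inj₂ (a , b , p , v∈)) → All.lookup (closed-verts cl (route I a b p) (φ∈U a)) v∈ }
  where φ∈U = λ a → closed-φ sc cl I a₀ a u
... | no ¬u = inj₂ λ
  { (inj₁ (a , refl))       → φ∉U a
  ; (inj₂ (a , b , p , v∈)) → φ∉U b ∘ closed-∈verts cl (route I a b p) v∈ }
  where φ∉U = λ a ua → ¬u (closed-φ sc cl I a a₀ ua)

HasDisjointCopies-map : (f : R ⇒ R′) → HasDisjointCopies k H R → HasDisjointCopies k H R′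
HasDisjointCopies-map f (cs , disj) = mapᴵ f ∘ cs , λ i j i≢j v v∈i v∈j →
  disj i j i≢j v (InCopy-mapᴵ⁻ f (cs i) v∈i) (InCopy-mapᴵ⁻ f (cs j) v∈j)

HasDisjointCopies-cons : (C : Immersion H R) (D : HasDisjointCopies k H R) →
                         (∀ i {v} → InCopy C v → InCopy (proj₁ D i) v → ⊥) →
                         HasDisjointCopies (suc k) H R
HasDisjointCopies-cons C (cs , disj) sep = copies , disjoint
  where
  copies : Fin (suc _) → Immersion _ _
  copies Fin.zero    = C
  copies (Fin.suc i) = cs i
  disjoint : ∀ i j → i ≢ j → ∀ v → InCopy (copies i) v → InCopy (copies j) v → ⊥
  disjoint Fin.zero    Fin.zero    i≢j = contradiction refl i≢j
  disjoint Fin.zero    (Fin.suc j) _   v v∈C v∈j = sep j v∈C v∈j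
  disjoint (Fin.suc i) Fin.zero    _   v v∈i v∈C = sep i v∈C v∈i
  disjoint (Fin.suc i) (Fin.suc j) i≢j = disj i j (i≢j ∘ cong Fin.suc)

Searchable : Set → Set₁
Searchable A = ∀ {P : A → Set} → Decidable P → Dec (∃ P)

search-Vec : Searchable A → ∀ m → Searchable (Vec A m)
search-Vec search zero    P? = map′ ([] ,_) (λ { ([] , p) → p }) (P? [])
search-Vec search (suc m) P? = map′ (λ (x , xs , p) → x ∷ xs , p) (λ { (x ∷ xs , p) → x , xs , p })
  (search (λ x → search-Vec search m (λ xs → P? (x ∷ xs))))

lists≤ : ℕ → List (List (Fin n))
lists≤ zero    = [] ∷ []
lists≤ (suc m) = [] ∷ cartesianProductWith _∷_ (allFin _) (lists≤ m)

∈-lists≤ : ∀ m (l : List (Fin n)) → length l ≤ m → l ∈ lists≤ m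
∈-lists≤ zero    []      _         = here refl
∈-lists≤ (suc m) []      _         = here refl
∈-lists≤ (suc m) (x ∷ l) (s≤s l≤m) =
  there (∈-cartesianProductWith⁺ _∷_ (∈-allFin x) (∈-lists≤ m l l≤m))

unique-lookup : {l : List (Fin n)} → Unique l → ∀ {i j} → i Fin.< j → lookup l i ≢ lookup l j
unique-lookup (x∉l ∷ _) {Fin.zero}  {Fin.suc j} _         = All.lookup x∉l (∈-lookup j)
unique-lookup (_ ∷ u)   {Fin.suc i} {Fin.suc j} (s≤s i<j) = unique-lookup u i<j

length-unique : (l : List (Fin n)) → Unique l → length l ≤ n
length-unique {n} l u with length l ≤? n
... | yes l≤n = l≤n
... | no  l≰n with i , j , i<j , eq ← Fin.pigeonhole (≰⇒> l≰n) (lookup l) =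
  contradiction eq (unique-lookup u i<j)

module _ (H : Digraph) {n : ℕ} {R : Fin n → Fin n → Set} (R? : ∀ x y → Dec (R x y)) where
  open UniqueDec (Fin._≟_ {n}) using (unique?)
  open MembershipDec (≡-dec (Fin._≟_ {n}) (Fin._≟_ {n})) using (_∉?_)

  private
    h : ℕ
    h = Digraph.size H

    Arc? : ∀ a b → Dec (Arc H a b)
    Arc? a b = Digraph.adj H a b Bool.≟ true

  WalkThrough : Fin n → Fin n → List (Fin n) → Set
  WalkThrough x y l = Σ (Walk R x y) λ w → verts w ≡ l

  head-verts : ∀ {x y z l} (w : Walk R x y) → verts w ≡ z ∷ l → x ≡ z
  head-verts []      refl = refl
  head-verts (_ ∷ _) refl = refl

  walkThrough? : ∀ x y l → Dec (WalkThrough x y l)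
  walkThrough? x y []           = no λ { ([] , ()) ; (_ ∷ _ , ()) }
  walkThrough? x y (z ∷ [])     = map′ (λ { (refl , refl) → [] , refl })
    (λ { ([] , refl) → refl , refl ; (_ ∷ [] , ()) ; (_ ∷ _ ∷ _ , ()) })
    ((x Fin.≟ z) ×-dec (x Fin.≟ y))
  walkThrough? x y (z ∷ z′ ∷ l) = map′ (λ { (refl , r , w , eq) → r ∷ w , cong (x ∷_) eq }) from
    ((x Fin.≟ z) ×-dec R? x z′ ×-dec walkThrough? z′ y (z′ ∷ l))
    where
    from : WalkThrough x y (z ∷ z′ ∷ l) → x ≡ z × R x z′ × WalkThrough z′ y (z′ ∷ l)
    from (r ∷ w , eq) with refl , eq′ ← ∷-injective eq with refl ← head-verts w eq′ = refl , r , w , eq′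

  IsImmersion : (Fin h → Fin n) → (Fin h → Fin h → List (Fin n)) → Set
  IsImmersion φ ρ =
      (∀ a b → φ a ≡ φ b → a ≡ b)
    × (∀ a b → Arc H a b → WalkThrough (φ a) (φ b) (ρ a b) × Unique (ρ a b))
    × (∀ a b a′ b′ → Arc H a b → Arc H a′ b′ → (a , b) ≢ (a′ , b′) →
         All (_∉ steps (ρ a′ b′)) (steps (ρ a b)))

  isImmersion? : ∀ φ ρ → Dec (IsImmersion φ ρ)
  isImmersion? φ ρ =
          Fin.all? (λ a → Fin.all? λ b → (φ a Fin.≟ φ b) →-dec (a Fin.≟ b))
    ×-dec Fin.all? (λ a → Fin.all? λ b →
            Arc? a b →-dec (walkThrough? (φ a) (φ b) (ρ a b) ×-dec unique? (ρ a b)))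
    ×-dec Fin.all? (λ a → Fin.all? λ b → Fin.all? λ a′ → Fin.all? λ b′ →
            Arc? a b →-dec (Arc? a′ b′ →-dec (¬? (≡-dec Fin._≟_ Fin._≟_ (a , b) (a′ , b′)) →-dec
              All.all? (_∉? steps (ρ a′ b′)) (steps (ρ a b)))))

  IsImmersion-resp : ∀ {φ φ′ ρ ρ′} → (∀ a → φ a ≡ φ′ a) → (∀ a b → ρ a b ≡ ρ′ a b) →
                     IsImmersion φ ρ → IsImmersion φ′ ρ′
  IsImmersion-resp {ρ′ = ρ′} eφ eρ (inj , walks , disj) =
      (λ a b eq → inj a b (trans (eφ a) (trans eq (sym (eφ b)))))
    , (λ a b p → let (w , ok) , u = walks a b p in
         subst₂ (λ x y → WalkThrough x y (ρ′ a b)) (eφ a) (eφ b) (w , trans ok (eρ a b))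
         , subst Unique (eρ a b) u)
    , λ a b a′ b′ p p′ ne →
         subst₂ (λ l l′ → All (_∉ steps l′) (steps l)) (eρ a b) (eρ a′ b′) (disj a b a′ b′ p p′ ne)

  IsImmersion⇒Immersion : ∀ {φ ρ} → IsImmersion φ ρ → Immersion H R
  IsImmersion⇒Immersion {φ} {ρ} (inj , walks , disj) = record
    { φ       = φ
    ; φ-inj   = inj _ _
    ; route   = λ a b p → proj₁ (proj₁ (walks a b p))
    ; isPath  = λ a b p → subst Unique (sym (proj₂ (proj₁ (walks a b p)))) (proj₂ (walks a b p))
    ; arcDisj = λ a b p a′ b′ p′ ne e e∈ e∈′ →
        All.lookup (disj a b a′ b′ p p′ ne) (arcs⊆steps a b p e∈) (arcs⊆steps a′ b′ p′ e∈′)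
    }
    where
    arcs⊆steps : ∀ a b p {e} → e ∈ arcs (proj₁ (proj₁ (walks a b p))) → e ∈ steps (ρ a b)
    arcs⊆steps a b p = let w , ok = proj₁ (walks a b p) in
      subst (_ ∈_) (trans (arcs≡steps w) (cong steps ok))

  module _ (I : Immersion H R) where
    route-list : Fin h → Fin h → List (Fin n)
    route-list a b with Arc? a b
    ... | yes p = verts (route I a b p)
    ... | no  _ = []

    route-list-arc : ∀ a b → Arc H a b → Σ (Arc H a b) λ p → route-list a b ≡ verts (route I a b p)
    route-list-arc a b p with Arc? a b
    ... | yes p′ = p′ , refl
    ... | no  ¬p = contradiction p ¬p

    route-list-length : ∀ a b → length (route-list a b) ≤ n
    route-list-length a b with Arc? a b
    ... | yes p = length-unique _ (isPath I a b p)
    ... | no  _ = z≤n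

    IsImmersion-route-list : IsImmersion (φ I) route-list
    IsImmersion-route-list = (λ a b → φ-inj I) , walks , disj
      where
      walks : ∀ a b → Arc H a b → WalkThrough (φ I a) (φ I b) (route-list a b) × Unique (route-list a b)
      walks a b p = let p′ , eq = route-list-arc a b p in
        (route I a b p′ , sym eq) , subst Unique (sym eq) (isPath I a b p′)
      disj : ∀ a b a′ b′ → Arc H a b → Arc H a′ b′ → (a , b) ≢ (a′ , b′) →
             All (_∉ steps (route-list a′ b′)) (steps (route-list a b))
      disj a b a′ b′ p p′ ne with q , eq ← route-list-arc a b p | q′ , eq′ ← route-list-arc a′ b′ p′ =
        All.tabulate λ {e} e∈ e∈′ → arcDisj I a b q a′ b′ q′ ne e (steps⊆arcs eq e∈) (steps⊆arcs eq′ e∈′)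
        where
        steps⊆arcs : ∀ {a b l e} {w : Walk R a b} → l ≡ verts w → e ∈ steps l → e ∈ arcs w
        steps⊆arcs {w = w} eq = subst (_ ∈_) (trans (cong steps eq) (sym (arcs≡steps w)))

  -- An immersion is determined by φ and the vertex lists of its routes; these are paths, hence of
  -- length at most n, so both range over finite sets.
  immersion? : Dec (Immersion H R)
  immersion? = map′ (λ (_ , _ , ok) → IsImmersion⇒Immersion ok) encode
    (search-Vec Fin.any? h λ φv → search-Vec (search-Vec Fin.any? h) h λ ιv →
      isImmersion? (Vec.lookup φv) (decode ιv))
    where
    decode : Vec (Vec (Fin _) h) h → Fin h → Fin h → List (Fin n)
    decode ιv a b = lookup (lists≤ n) (Vec.lookup (Vec.lookup ιv a) b)
    encode : Immersion H R → ∃ λ φv → ∃ λ ιv → IsImmersion (Vec.lookup φv) (decode ιv)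
    encode I = tabulate (φ I) , tabulate (λ a → tabulate (index a)) ,
      IsImmersion-resp (λ a → sym (lookup∘tabulate (φ I) a)) decode-index (IsImmersion-route-list I)
      where
      index : Fin h → Fin h → Fin _
      index a b = Any.index (∈-lists≤ n (route-list I a b) (route-list-length I a b))
      decode-index : ∀ a b → route-list I a b ≡ decode (tabulate (λ a → tabulate (index a))) a b
      decode-index a b = trans (lookup-index (∈-lists≤ n (route-list I a b) (route-list-length I a b)))
        (cong (lookup (lists≤ n)) (sym (trans (cong (λ v → Vec.lookup v b) (lookup∘tabulate _ a))
                                               (lookup∘tabulate (index a) b))))

length-filterᵇ : (f : A → Bool) (xs : List A) →
                 length (filterᵇ f xs) ≡ sum (map (λ x → if f x then 1 else 0) xs)
length-filterᵇ f []       = refl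
length-filterᵇ f (x ∷ xs) with f x
... | true  = cong suc (length-filterᵇ f xs)
... | false = length-filterᵇ f xs

≤-foldr-⊔ : ∀ {m} (xs : List ℕ) → m ∈ xs → m ≤ foldr _⊔_ 0 xs
≤-foldr-⊔ (x ∷ xs) (here refl) = m≤m⊔n x _
≤-foldr-⊔ (x ∷ xs) (there m∈) = ≤-trans (≤-foldr-⊔ xs m∈) (m≤n⊔m x _)

upcrossing : {P : ℕ → Set} → (∀ α → Dec (P α)) → ¬ P 0 →
             ∀ N → ¬ P N ⊎ ∃[ γ ] (suc γ ≤ N × ¬ P γ × P (suc γ))
upcrossing P? ¬P0 zero    = inj₁ ¬P0
upcrossing P? ¬P0 (suc N) with P? (suc N) | upcrossing P? ¬P0 N
... | no ¬PN+1 | _                            = inj₁ ¬PN+1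
... | yes PN+1 | inj₁ ¬PN                     = inj₂ (N , ≤-refl , ¬PN , PN+1)
... | yes _    | inj₂ (γ , γ<N , ¬Pγ , Pγ+1) = inj₂ (γ , m≤n⇒m≤1+n γ<N , ¬Pγ , Pγ+1)

module CutRecursion
  (H : Digraph) (simple : IsSimple H) (strong : StronglyConnected H) (hasArc : HasArc H)
  (T : Digraph) (σ : Fin (Digraph.size T) → Fin (Digraph.size T)) (σ-inj : Injective _≡_ _≡_ σ)
  (c : ℕ) (width≤c : width T σ ≤ c)
  where
  open Equivalence

  N : ℕ
  N = Digraph.size T

  pos : Fin N → ℕ
  pos v = toℕ (σ v)

  Above : ℕ → Fin N → Set
  Above α v = α ≤ pos v

  Between : ℕ → ℕ → Fin N → Set
  Between β α v = β ≤ pos v × pos v < α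

  Window : ℕ → ℕ → Fin N → Fin N → Set
  Window β α = Arc T ↾ Between β α

  window? : ∀ β α u v → Dec (Window β α u v)
  window? β α u v = (Digraph.adj T u v Bool.≟ true)
    ×-dec ((β ≤? pos u) ×-dec (pos u <? α)) ×-dec ((β ≤? pos v) ×-dec (pos v <? α))

  Remainder : ℕ → List (Fin N × Fin N) → Fin N → Fin N → Set
  Remainder β F = Delete T F ↾ Above β

  crosses : ℕ → Fin N × Fin N → Bool
  crosses α (u , v) = Digraph.adj T u v ∧ (α ≤ᵇ pos u) ∧ (pos v <ᵇ α)

  pairs : List (Fin N × Fin N)
  pairs = cartesianProduct (allFin N) (allFin N)

  Cut : ℕ → List (Fin N × Fin N)
  Cut α = filterᵇ (crosses α) pairs

  length-Cut : ∀ α → α ≤ N → length (Cut α) ≤ c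
  length-Cut α α≤N = subst (_≤ c) (sym (length-filterᵇ (crosses α) pairs))
    (≤-trans (≤-foldr-⊔ _ (∈-map⁺ (cutSize T σ) (∈-upTo⁺ (s≤s α≤N)))) width≤c)

  ∈-Cut : ∀ {α u v} → Arc T u v → α ≤ pos u → pos v < α → (u , v) ∈ Cut α
  ∈-Cut uv α≤u v<α = ∈-filter⁺ _ (∈-cartesianProduct⁺ (∈-allFin _) (∈-allFin _))
    (T-∧ .from (T-≡ .from uv , T-∧ .from (≤⇒≤ᵇ α≤u , <⇒<ᵇ v<α)))

  Cut-arcs : ∀ α → All (λ e → Arc T (proj₁ e) (proj₂ e)) (Cut α)
  Cut-arcs α = All.tabulate λ e∈ →
    T-≡ .to (proj₁ (T-∧ .to (proj₂ (∈-filter⁻ (Bool.T? ∘ crosses α) {xs = pairs} e∈))))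

  Cut-closed : ∀ {α F} → (_∈ Cut α) ⊆ (_∈ F) → Closed (Delete T F) (Above α)
  Cut-closed {α} Cut⊆F {u} {v} (uv , uv∉F) α≤u with α ≤? pos v
  ... | yes α≤v = α≤v
  ... | no  α≰v = contradiction (Cut⊆F (∈-Cut uv α≤u (≰⇒> α≰v))) uv∉F

  a₀ : Fin (Digraph.size H)
  a₀ = proj₁ hasArc

  out : ∀ a → ∃[ b ] Arc H a b
  out = out-arc strong hasArc

  InCopy-Between : ∀ {β α} (I : Immersion H (Window β α)) → InCopy I ⊆ Between β α
  InCopy-Between = InCopy-↾ simple out

  β<α : ∀ {β α} → Immersion H (Window β α) → β < α
  β<α C = let β≤a , a<α = InCopy-Between C (inj₁ (a₀ , refl)) in <-≤-trans (s≤s β≤a) a<α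

  widen : ∀ {β β′ α α′} → β′ ≤ β → α ≤ α′ → Window β α ⇒ Window β′ α′
  widen β′≤β α≤α′ (uv , (β≤u , u<α) , (β≤v , v<α)) =
    uv , (≤-trans β′≤β β≤u , <-≤-trans u<α α≤α′) , (≤-trans β′≤β β≤v , <-≤-trans v<α α≤α′)

  stack : ∀ {k β α} → Immersion H (Window β α) → α ≤ N →
          HasDisjointCopies k H (Window α N) → HasDisjointCopies (suc k) H (Window β N)
  stack C α≤N D = HasDisjointCopies-cons (mapᴵ (widen ≤-refl α≤N) C)
    (HasDisjointCopies-map (widen (<⇒≤ (β<α C)) ≤-refl) D)
    λ i v∈C v∈D → <⇒≱ (proj₂ (InCopy-Between C (InCopy-mapᴵ⁻ _ C v∈C)))
                      (proj₁ (InCopy-Between (proj₁ D i) (InCopy-mapᴵ⁻ _ (proj₁ D i) v∈D)))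

  InCopy-pos-not-constant : ∀ {R : Fin N → Fin N → Set} {γ} (I : Immersion H R) →
                            ¬ (InCopy I ⊆ (λ v → pos v ≡ γ))
  InCopy-pos-not-constant I at = let a , b , ab = hasArc in
    arc⇒≢ {H} {a} {b} simple ab (φ-inj I (σ-inj (Fin.toℕ-injective
      (trans (at (inj₁ (a , refl))) (sym (at (inj₁ (b , refl))))))))

  above-or-below : ∀ {β γ F} → Immersion H (Remainder β (Cut γ ++ Cut (suc γ) ++ F)) →
          Immersion H (Remainder (suc γ) F) ⊎ Immersion H (Window β γ)
  above-or-below {β} {γ} {F} I
    with InCopy-one-side strong a₀ (λ v → suc γ ≤? pos v)
           (Closed-↾ {P = Above β} (Cut-closed (∈-++⁺ʳ (Cut γ) ∘ ∈-++⁺ˡ))) I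
  ... | inj₁ above = inj₁ (restrictᴵ (mapᴵ drop-cuts I) (above ∘ InCopy-mapᴵ⁻ drop-cuts I))
    where
    drop-cuts : Remainder β (Cut γ ++ Cut (suc γ) ++ F) ⇒ Delete T F
    drop-cuts ((uv , uv∉) , _) = uv , uv∉ ∘ ∈-++⁺ʳ (Cut γ) ∘ ∈-++⁺ʳ (Cut (suc γ))
  ... | inj₂ below
    with InCopy-one-side strong a₀ (λ v → γ ≤? pos v) (Closed-↾ {P = Above β} (Cut-closed ∈-++⁺ˡ)) I
  ...   | inj₁ at    =
          ⊥-elim (InCopy-pos-not-constant I λ v∈ → ≤-antisym (≤-pred (≰⇒> (below v∈))) (at v∈))
  ...   | inj₂ below′ = inj₂ (restrictᴵ (mapᴵ (proj₁ ∘ proj₁) I) λ v∈ →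
          let v∈I = InCopy-mapᴵ⁻ (proj₁ ∘ proj₁) I v∈ in InCopy-↾ simple out I v∈I , ≰⇒> (below′ v∈I))

  Hitting : ℕ → ℕ → Set
  Hitting j β = Σ (List (Fin N × Fin N)) λ F →
    All (λ e → Arc T (proj₁ e) (proj₂ e)) F × length F ≤ 2 * j * c × ¬ Immersion H (Remainder β F)

  hitting : ∀ j β → ¬ HasDisjointCopies (suc j) H (Window β N) → Hitting j β
  hitting j β none with upcrossing (λ α → immersion? H (window? β α)) (λ C → n≮0 (β<α C)) N
  ... | inj₁ no-copy = [] , [] , z≤n , λ I → no-copy (restrictᴵ (mapᴵ (proj₁ ∘ proj₁) I) λ v∈ →
          InCopy-↾ simple out I (InCopy-mapᴵ⁻ (proj₁ ∘ proj₁) I v∈) , Fin.toℕ<n (σ _))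
  hitting zero    β none | inj₂ (γ , γ<N , _ , C) = ⊥-elim (none (stack C γ<N ((λ ()) , λ ())))
  hitting (suc j) β none | inj₂ (γ , γ<N , no-copy , C) with hitting j (suc γ) (none ∘ stack C γ<N)
  ... | F , F-arcs , |F|≤ , F-hits =
    Cut γ ++ Cut (suc γ) ++ F ,
    All.++⁺ (Cut-arcs γ) (All.++⁺ (Cut-arcs (suc γ)) F-arcs) ,
    length-bound ,
    [ F-hits , no-copy ] ∘ above-or-below
    where
    length-bound : length (Cut γ ++ Cut (suc γ) ++ F) ≤ 2 * suc j * c
    length-bound = begin
      length (Cut γ ++ Cut (suc γ) ++ F)
        ≡⟨ length-++ (Cut γ) ⟩
      length (Cut γ) + length (Cut (suc γ) ++ F)
        ≡⟨ cong (length (Cut γ) +_) (length-++ (Cut (suc γ))) ⟩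
      length (Cut γ) + (length (Cut (suc γ)) + length F)
        ≤⟨ +-mono-≤ (length-Cut γ (<⇒≤ γ<N)) (+-mono-≤ (length-Cut (suc γ) γ<N) |F|≤) ⟩
      c + (c + 2 * j * c)
        ≡⟨ regroup c j ⟩
      2 * suc j * c
        ∎
      where
      open ≤-Reasoning
      regroup : ∀ c j → c + (c + 2 * j * c) ≡ 2 * suc j * c
      regroup = solve-∀

lemma17 : (H : Digraph) → IsSimple H → StronglyConnected H → HasArc H →
          (k : ℕ) → k ≥ 1 → (c : ℕ) →
          (T : Digraph) → IsTournament T → CtwAtMost T c →
          ¬ HasDisjointCopies k H (Arc T) →
          Σ (List (Fin (Digraph.size T) × Fin (Digraph.size T))) λ F →
            All (λ e → Arc T (Data.Product.proj₁ e) (Data.Product.proj₂ e)) F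
            × length F ≤ 2 * (k ∸ 1) * c
            × ¬ ContainsImmersion H (Delete T F)
lemma17 H simple strong hasArc (suc j) _ c T _ (σ , width≤c) no-copies =
  let F , F-arcs , |F|≤ , F-hits = hitting j 0 (no-copies ∘ HasDisjointCopies-map proj₁) in
  F , F-arcs , |F|≤ , F-hits ∘ mapᴵ (λ uv → uv , z≤n , z≤n)
  where open CutRecursion H simple strong hasArc T (Bijection.to σ) (Bijection.injective σ) c width≤c
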